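{- Let $(a,b,c)$ be a triple of positive integers with $a=b+c$ (so $a=n/2$ where $n=a+b+c$) and with $b$ and $c$ relatively prime. Then $(a,b,c)$ is a good triple.
   Context: For positive integers $a,b,c$ with $n=a+b+c$, the permutation of the triple $(a,b,c)$ is the permutation of $[n]$ with $p_i=n+1-i$ for $1\le i\le a$, $p_i=a+b+1-i$ for $a+1\le i\le a+b$, and $p_i=n+b+1-i$ for $a+b+1\le i\le n$ (one-line notation $n\cdots(n-a+1)\ b\cdots1\ (b+c)\cdots(b+1)$). The triple is good if this permutation, as a bijection $i\mapsto p_i$ of $[n]$, is a single $n$-cycle. -}

module Defs where

open import Data.Nat using (ℕ; zero; suc; _+_; _∸_; _≤_; _<_; _≤ᵇ_)
open import Data.Bool using (if_then_else_)
open import Data.Product using (_×_)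
open import Relation.Binary.PropositionalEquality using (_≡_)
open import Relation.Nullary using (¬_)

-- The permutation of the triple (a,b,c), as a function on ℕ, meaningful on [1..n]
-- with n = a+b+c:
--   p i = n+1-i      for 1 ≤ i ≤ a
--   p i = a+b+1-i    for a+1 ≤ i ≤ a+b
--   p i = n+b+1-i    for a+b+1 ≤ i ≤ n
triplePerm : ℕ → ℕ → ℕ → ℕ → ℕ
triplePerm a b c i =
  if i ≤ᵇ a then suc (a + b + c) ∸ i
  else if i ≤ᵇ a + b then suc (a + b) ∸ i
  else suc (a + b + c + b) ∸ i

iter : (ℕ → ℕ) → ℕ → ℕ → ℕ
iter f zero x = x
iter f (suc k) x = f (iter f k x)

-- A permutation p of [n] = {1,…,n} is a single n-cycle iff the orbit of 1
-- has exactly n elements: p^k(1) ≠ 1 for 0 < k < n, and p^n(1) = 1.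
IsNCycle : ℕ → (ℕ → ℕ) → Set
IsNCycle n p = (∀ k → 0 < k → k < n → ¬ (iter p k 1 ≡ 1)) × (iter p n 1 ≡ 1)

Good : ℕ → ℕ → ℕ → Set
Good a b c = IsNCycle (a + b + c) (triplePerm a b c)

{-# OPTIONS --safe #-}
module Submission where

-- When a = b + c, the permutation p maps the lower half [1, a] into the upper half, and
-- p² acts on the lower half as the rotation 1 + r ↦ 1 + ((r + b) mod a).  Hence the orbit
-- of 1 alternates between the halves, its even members are 1 + (m b mod a), and it first
-- returns to 1 when a ∣ m b, that is (as gcd(a, b) = gcd(b, c) = 1) when m = a: the orbit
-- has length 2a = n.

open import Defs
open import Data.Nat using (ℕ; _<_; _+_)
open import Data.Nat.Coprimality using (Coprime)
open import Relation.Binary.PropositionalEquality using (_≡_)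

open import Data.Bool using (true; false)
open import Data.Bool.Properties using (T-≡; ¬-not)
open import Data.Nat
  using (zero; suc; _*_; _∸_; _≤_; _≤ᵇ_; s≤s; z<s; _<?_; NonZero; >-nonZero; >-nonZero⁻¹)
open import Data.Nat.Properties
open import Data.Nat.DivMod
  using (_%_; m%n<n; m<n⇒m%n≡m; m%n%n≡m%n; %-distribˡ-+; [m+n]%n≡m%n; m*n%n≡0)
open import Data.Nat.Divisibility using (_∣_; m%n≡0⇒n∣m; ∣⇒≤)
open import Data.Nat.Coprimality using (coprime-divisor; coprime-+)
import Data.Nat.Coprimality as Coprimality
open import Data.Nat.Tactic.RingSolver using (solve-∀)
open import Data.Product using (Σ-syntax; _,_)
open import Data.Sum using (_⊎_; inj₁; inj₂)
open import Function using (_∘_)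
open import Function.Bundles using (Equivalence)
open import Relation.Nullary using (¬_; yes; no; contradiction)
open import Relation.Binary.PropositionalEquality
  using (refl; sym; trans; cong; subst; module ≡-Reasoning)

private variable a b c i j m r : ℕ

≤⇒≤ᵇ≡true : i ≤ a → (i ≤ᵇ a) ≡ true
≤⇒≤ᵇ≡true i≤a = Equivalence.to T-≡ (≤⇒≤ᵇ i≤a)

>⇒≤ᵇ≡false : a < i → (i ≤ᵇ a) ≡ false
>⇒≤ᵇ≡false {a} {i} a<i = ¬-not (<⇒≱ a<i ∘ ≤ᵇ⇒≤ i a ∘ Equivalence.from T-≡)

j+i≡m⇒m∸i≡j : j + i ≡ m → m ∸ i ≡ j
j+i≡m⇒m∸i≡j {j} {i} refl = m+n∸n≡m j i

even⊎odd : ∀ k → (Σ[ m ∈ ℕ ] k ≡ m + m) ⊎ (Σ[ m ∈ ℕ ] k ≡ suc (m + m))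
even⊎odd zero = inj₁ (0 , refl)
even⊎odd (suc k) with even⊎odd k
... | inj₁ (m , refl) = inj₂ (m , refl)
... | inj₂ (m , refl) = inj₁ (suc m , cong suc (sym (+-suc m m)))

coprime⇒*%≢0 : .{{_ : NonZero a}} → Coprime a b → 0 < m → m < a → ¬ ((m * b) % a ≡ 0)
coprime⇒*%≢0 {a} {b} {m} a⊥b 0<m m<a m*b%a≡0 =
  <⇒≱ m<a (∣⇒≤ {{>-nonZero 0<m}} (coprime-divisor a⊥b a∣b*m))
  where
  a∣b*m : a ∣ b * m
  a∣b*m = subst (a ∣_) (*-comm m b) (m%n≡0⇒n∣m (m * b) a m*b%a≡0)

[m%n+o]%n≡[m+o]%n : ∀ m o n .{{_ : NonZero n}} → (m % n + o) % n ≡ (m + o) % n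
[m%n+o]%n≡[m+o]%n m o n = begin
  (m % n + o) % n          ≡⟨ %-distribˡ-+ (m % n) o n ⟩
  (m % n % n + o % n) % n  ≡⟨ cong (λ x → (x + o % n) % n) (m%n%n≡m%n m n) ⟩
  (m % n + o % n) % n      ≡⟨ %-distribˡ-+ m o n ⟨
  (m + o) % n              ∎
  where open ≡-Reasoning

-- The value of p is characterised by j + i ≡ … rather than computed as … ∸ i, so that
-- the side conditions below are semiring identities.
triplePerm-lower : i ≤ a → j + i ≡ suc (a + b + c) → triplePerm a b c i ≡ j
triplePerm-lower i≤a eq rewrite ≤⇒≤ᵇ≡true i≤a = j+i≡m⇒m∸i≡j eq

triplePerm-middle : a < i → i ≤ a + b → j + i ≡ suc (a + b) → triplePerm a b c i ≡ j
triplePerm-middle a<i i≤a+b eq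
  rewrite >⇒≤ᵇ≡false a<i | ≤⇒≤ᵇ≡true i≤a+b = j+i≡m⇒m∸i≡j eq

triplePerm-upper : a + b < i → j + i ≡ suc (a + b + c + b) → triplePerm a b c i ≡ j
triplePerm-upper {a} {b} a+b<i eq
  rewrite >⇒≤ᵇ≡false (≤-<-trans (m≤m+n a b) a+b<i) | >⇒≤ᵇ≡false a+b<i
  = j+i≡m⇒m∸i≡j eq

b+c<triplePerm-lower : i ≤ a → b + c < triplePerm a b c i
b+c<triplePerm-lower {i} {a} {b} {c} i≤a with m≤n⇒∃[o]m+o≡n i≤a
... | d , refl =
  subst (b + c <_) (sym (triplePerm-lower i≤a (identity i d b c))) (s≤s (m≤n+m (b + c) d))
  where
  identity : ∀ i d b c → suc (d + (b + c)) + i ≡ suc (i + d + b + c)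
  identity = solve-∀

triplePerm²-below : .{{_ : NonZero (b + c)}} → r < c →
  triplePerm (b + c) b c (triplePerm (b + c) b c (suc r)) ≡ suc ((r + b) % (b + c))
triplePerm²-below {b} {c} {r} r<c with m≤n⇒∃[o]m+o≡n r<c
... | s , refl = begin
  p (p (suc r))         ≡⟨ cong p first-step ⟩
  p (half + b + suc s)  ≡⟨ second-step ⟩
  suc (r + b)           ≡⟨ cong suc (m<n⇒m%n≡m r+b<half) ⟨
  suc ((r + b) % half)  ∎
  where
  open ≡-Reasoning
  half = b + (suc r + s)
  p = triplePerm half b (suc r + s)
  1+r≤half : suc r ≤ half
  1+r≤half = ≤-trans (m≤m+n (suc r) s) (m≤n+m _ b)
  r+b<half : r + b < half
  r+b<half = subst (r + b <_) (+-comm (suc r + s) b) (+-monoˡ-< b r<c)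
  identity₁ : ∀ b r s →
    b + (suc r + s) + b + suc s + suc r ≡ suc (b + (suc r + s) + b + (suc r + s))
  identity₁ = solve-∀
  identity₂ : ∀ b r s →
    suc (r + b) + (b + (suc r + s) + b + suc s) ≡ suc (b + (suc r + s) + b + (suc r + s) + b)
  identity₂ = solve-∀
  first-step : p (suc r) ≡ half + b + suc s
  first-step = triplePerm-lower 1+r≤half (identity₁ b r s)
  second-step : p (half + b + suc s) ≡ suc (r + b)
  second-step = triplePerm-upper (m<m+n (half + b) z<s) (identity₂ b r s)

triplePerm²-above : .{{_ : NonZero (b + c)}} → c ≤ r → r < b + c →
  triplePerm (b + c) b c (triplePerm (b + c) b c (suc r)) ≡ suc ((r + b) % (b + c))
triplePerm²-above {b} {c} {r} c≤r r<b+c with m≤n⇒∃[o]m+o≡n c≤r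
... | s , refl with m≤n⇒∃[o]m+o≡n (+-cancelˡ-< c s b (subst (c + s <_) (+-comm b c) r<b+c))
...   | t , refl = begin
  p (p (suc (c + s)))                 ≡⟨ cong p first-step ⟩
  p (half + suc t)                    ≡⟨ second-step ⟩
  suc s                               ≡⟨ cong suc (m<n⇒m%n≡m s<half) ⟨
  suc (s % half)                      ≡⟨ cong suc ([m+n]%n≡m%n s half) ⟨
  suc ((s + half) % half)             ≡⟨ cong (λ x → suc (x % half)) (identity₃ s t c) ⟩
  suc ((c + s + (suc s + t)) % half)  ∎
  where
  open ≡-Reasoning
  half = suc s + t + c
  p = triplePerm half (suc s + t) c
  identity₀ : ∀ s t c → suc (c + s) + t ≡ suc s + t + c
  identity₀ = solve-∀
  1+r≤half : suc (c + s) ≤ half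
  1+r≤half = subst (suc (c + s) ≤_) (identity₀ s t c) (m≤m+n (suc (c + s)) t)
  j≤half+b : half + suc t ≤ half + (suc s + t)
  j≤half+b = +-monoʳ-≤ half (s≤s (m≤n+m t s))
  s<half : s < half
  s<half = ≤-trans (m≤m+n (suc s) t) (m≤m+n _ c)
  identity₁ : ∀ s t c →
    suc s + t + c + suc t + suc (c + s) ≡ suc (suc s + t + c + (suc s + t) + c)
  identity₁ = solve-∀
  identity₂ : ∀ s t c → suc s + (suc s + t + c + suc t) ≡ suc (suc s + t + c + (suc s + t))
  identity₂ = solve-∀
  identity₃ : ∀ s t c → s + (suc s + t + c) ≡ c + s + (suc s + t)
  identity₃ = solve-∀
  first-step : p (suc (c + s)) ≡ half + suc t
  first-step = triplePerm-lower 1+r≤half (identity₁ s t c)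
  second-step : p (half + suc t) ≡ suc s
  second-step = triplePerm-middle (m<m+n half z<s) j≤half+b (identity₂ s t c)

triplePerm²-rotate : .{{_ : NonZero (b + c)}} → r < b + c →
  triplePerm (b + c) b c (triplePerm (b + c) b c (suc r)) ≡ suc ((r + b) % (b + c))
triplePerm²-rotate {c = c} {r} r<b+c with r <? c
... | yes r<c = triplePerm²-below r<c
... | no  r≮c = triplePerm²-above (≮⇒≥ r≮c) r<b+c

module _ (b c : ℕ) .{{_ : NonZero (b + c)}} where
  private
    p : ℕ → ℕ
    p = triplePerm (b + c) b c

  iter-triplePerm-even : ∀ m → iter p (m + m) 1 ≡ suc ((m * b) % (b + c))
  iter-triplePerm-even zero = cong suc (sym (m*n%n≡0 0 (b + c)))
  iter-triplePerm-even (suc m) = begin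
    iter p (suc (m + suc m)) 1               ≡⟨ cong (λ k → iter p (suc k) 1) (+-suc m m) ⟩
    p (p (iter p (m + m) 1))                 ≡⟨ cong (p ∘ p) (iter-triplePerm-even m) ⟩
    p (p (suc ((m * b) % (b + c))))          ≡⟨ triplePerm²-rotate {b} {c} (m%n<n (m * b) _) ⟩
    suc (((m * b) % (b + c) + b) % (b + c))  ≡⟨ cong suc ([m%n+o]%n≡[m+o]%n (m * b) b _) ⟩
    suc ((m * b + b) % (b + c))              ≡⟨ cong (λ x → suc (x % _)) (+-comm (m * b) b) ⟩
    suc ((suc m * b) % (b + c))              ∎
    where open ≡-Reasoning

  b+c<iter-triplePerm-odd : ∀ m → b + c < iter p (suc (m + m)) 1
  b+c<iter-triplePerm-odd m rewrite iter-triplePerm-even m =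
    b+c<triplePerm-lower {a = b + c} {b} {c} (m%n<n (m * b) (b + c))

  coprime⇒Good[b+c] : Coprime b c → Good (b + c) b c
  coprime⇒Good[b+c] b⊥c = no-early-return , returns
    where
    open ≡-Reasoning
    b+c⊥b : Coprime (b + c) b
    b+c⊥b = coprime-+ (Coprimality.sym b⊥c)
    n≡[b+c]+[b+c] : b + c + b + c ≡ (b + c) + (b + c)
    n≡[b+c]+[b+c] = +-assoc (b + c) b c
    no-early-return : ∀ k → 0 < k → k < b + c + b + c → ¬ (iter p k 1 ≡ 1)
    no-early-return k 0<k k<n with even⊎odd k
    ... | inj₁ (zero , refl) = contradiction 0<k (<-irrefl refl)
    ... | inj₁ (suc m , refl) =
      coprime⇒*%≢0 b+c⊥b z<s m<b+c ∘ suc-injective ∘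
        trans (sym (iter-triplePerm-even (suc m)))
      where
      m<b+c : suc m < b + c
      m<b+c = ≰⇒> λ b+c≤m →
        <⇒≱ (subst (suc m + suc m <_) n≡[b+c]+[b+c] k<n) (+-mono-≤ b+c≤m b+c≤m)
    ... | inj₂ (m , refl) = λ eq →
      <⇒≱ (subst (b + c <_) eq (b+c<iter-triplePerm-odd m)) (>-nonZero⁻¹ (b + c))
    returns : iter p (b + c + b + c) 1 ≡ 1
    returns = begin
      iter p (b + c + b + c) 1       ≡⟨ cong (λ k → iter p k 1) n≡[b+c]+[b+c] ⟩
      iter p ((b + c) + (b + c)) 1   ≡⟨ iter-triplePerm-even (b + c) ⟩
      suc (((b + c) * b) % (b + c))  ≡⟨ cong (λ x → suc (x % (b + c))) (*-comm (b + c) b) ⟩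
      suc ((b * (b + c)) % (b + c))  ≡⟨ cong suc (m*n%n≡0 b (b + c)) ⟩
      1                              ∎

theorem10 : (a b c : ℕ) → 0 < a → 0 < b → 0 < c → a ≡ b + c → Coprime b c →
              Good a b c
theorem10 _ b c 0<a _ _ refl b⊥c = coprime⇒Good[b+c] b c {{>-nonZero 0<a}} b⊥c
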